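{- There is no constant $c$ such that every series-parallel graph $G$ has a partition of $V(G)$ into two sets $V_1,V_2$ such that $G[V_1]$ and $G[V_2]$ each have pathwidth at most $c$.
   Context: A series-parallel graph is a graph with no $K_4$ minor (equivalently, of treewidth at most 2). Pathwidth is the standard notion. -}

module Defs where

open import Data.Nat using (ℕ; suc; _≤_)
open import Data.Fin using (Fin; toℕ)
open import Data.List using (List; length)
open import Data.List.Membership.Propositional using (_∈_)
open import Data.Maybe using (Maybe; just)
open import Data.Product using (Σ; ∃; _×_; _,_)
open import Data.Bool using (Bool; true; false)
open import Relation.Binary.PropositionalEquality using (_≡_; _≢_)
open import Relation.Nullary using (¬_)

record Graph (V : Set) : Set₁ where
  field
    Adj    : V → V → Set
    sym    : ∀ {u v} → Adj u v → Adj v u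
    irrefl : ∀ {v} → ¬ Adj v v
open Graph public

induced : {V : Set} → Graph V → (S : V → Set) → Graph (Σ V S)
induced G S = record
  { Adj    = λ { (u , _) (v , _) → Adj G u v }
  ; sym    = λ {x} {y} → aux x y
  ; irrefl = λ {x} → aux2 x }
  where
    aux : (x y : Σ _ S) → _
    aux (u , _) (v , _) a = sym G a
    aux2 : (x : Σ _ S) → _
    aux2 (v , _) a = irrefl G a

-- Walk from u to v in G all of whose vertices after u lie in P.
data WalkIn {V : Set} (G : Graph V) (P : V → Set) : V → V → Set where
  here : ∀ {u} → WalkIn G P u u
  step : ∀ {u w v} → Adj G u w → P w → WalkIn G P w v → WalkIn G P u v

-- A K4-minor model: each vertex lies in at most one branch set
-- (β v ≡ just i means v is in branch set i); branch sets are nonempty,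
-- induce connected subgraphs, and any two distinct branch sets are joined by an edge.
record K4Model {n : ℕ} (G : Graph (Fin n)) : Set where
  field
    β         : Fin n → Maybe (Fin 4)
    nonempty  : ∀ i → ∃ λ v → β v ≡ just i
    connected : ∀ i u v → β u ≡ just i → β v ≡ just i →
                WalkIn G (λ w → β w ≡ just i) u v
    adjacent  : ∀ i j → i ≢ j →
                ∃ λ u → ∃ λ v → β u ≡ just i × β v ≡ just j × Adj G u v

HasK4Minor : {n : ℕ} → Graph (Fin n) → Set
HasK4Minor G = K4Model G

SeriesParallel : {n : ℕ} → Graph (Fin n) → Set
SeriesParallel G = ¬ HasK4Minor G

record PathDecomposition {V : Set} (G : Graph V) (c : ℕ) : Set where
  field
    m        : ℕ
    bag      : Fin m → List V
    width    : ∀ i → length (bag i) ≤ suc c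
    covers   : ∀ v → ∃ λ i → v ∈ bag i
    edges    : ∀ u v → Adj G u v → ∃ λ i → u ∈ bag i × v ∈ bag i
    interval : ∀ v (i j k : Fin m) → toℕ i ≤ toℕ j → toℕ j ≤ toℕ k →
               v ∈ bag i → v ∈ bag k → v ∈ bag j

PathwidthAtMost : {V : Set} → Graph V → ℕ → Set
PathwidthAtMost G c = PathDecomposition G c

module Submission where

-- The engine is a branching lemma for path decompositions.  Call a connected
-- set A of colour b "k-rooted" at x ∈ A if some bag (of the decomposition of
-- colour class b) contains k+1 vertices of A.  If x has colour b and is
-- adjacent to the roots of three pairwise disjoint k-rooted sets avoiding x,
-- then their union with x is (k+1)-rooted: the bag of one of the three sets
-- lies between the other two bags, and the walk between the other two sets
-- through x crosses it outside the middle set.  A (c+1)-rooted set cannot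
-- exist, since bags have at most c+1 vertices.
--
-- For H = c+1 the graph G_H is a ternary tree of height H whose every edge
-- carries a recursive 2-tree gadget: five common neighbours ("apexes") of
-- the ends, with smaller gadgets on the new edges.  Every vertex has at most
-- two, adjacent, parents of smaller depth, so G_H has no K4 minor.  In any
-- 2-colouring, a gadget whose ends differ in colour is H-rooted at one end
-- (three apexes share a colour; induction on the budgets), so every tree edge
-- is monochromatic, and then the tree itself is H-rooted at its root.

open import Defs renaming (sym to adj-sym)
open import Data.Nat using (ℕ; zero; suc; _+_; _*_; _⊔_; _≤_; _<_; z≤n; s≤s; s≤s⁻¹)
open import Data.Nat.Properties as ℕ using (≤-total; ≤-trans; ≰⇒>; <⇒≤)
open import Data.Fin using (Fin; zero; suc; toℕ; punchIn)
open import Data.Fin.Patterns using (0F; 1F; 2F; 3F; 4F)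
open import Data.Fin.Properties using (pigeonhole; any?; punchIn-injective; punchInᵢ≢i; toℕ<n; toℕ-injective; +↔⊎; *↔×) renaming (_≟_ to _≟ᶠ_; <-irrefl to <ᶠ-irrefl)
open import Data.List using (List; length)
open import Data.List.Membership.Propositional using (_∈_)
open import Data.List.Membership.Setoid.Properties using (index-injective)
open import Data.List.Relation.Unary.Any using (index)
open import Data.Bool using (Bool; true; false)
open import Data.Maybe using (Maybe; just; nothing)
import Data.Maybe.Properties
open import Data.Bool.Properties using () renaming (_≟_ to _≟ᴮ_)
open import Data.Product using (Σ; ∃; _×_; _,_; proj₁; proj₂)
open import Data.Sum using (_⊎_; inj₁; inj₂; [_,_])
open import Data.Empty using (⊥; ⊥-elim)
open import Data.Vec.Functional using (_∷_)
open import Function using (case_of_)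
open import Function.Definitions using (Injective)
open import Function.Bundles using (_↔_; Inverse; Injection; mk↔ₛ′)
open import Function.Properties.Inverse using (Inverse⇒Injection; ↔-refl; ↔-sym; ↔-trans)
open import Function.Related.Propositional using (module EquationalReasoning)
open import Data.Sum.Function.Propositional using (_⊎-↔_)
open import Data.Product.Function.NonDependent.Propositional using (_×-↔_)
open import Axiom.UniquenessOfIdentityProofs using (module Decidable⇒UIP)
open import Level using (0ℓ)
open import Relation.Unary using (Pred; _⊆_; _∪_; _∉_; ｛_｝)
open import Relation.Binary.PropositionalEquality using (_≡_; _≢_; refl; sym; trans; cong; subst; subst₂; setoid)
open import Relation.Nullary using (¬_; yes; no; Dec)
open import Relation.Binary using (tri<; tri≈; tri>)

Distinct : {A B : Set} → (A → B) → Set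
Distinct w = Injective _≡_ _≡_ w

cons-distinct : {A : Set} {n : ℕ} {z : A} {w : Fin n → A} →
                (∀ i → w i ≢ z) → Distinct w → Distinct (z ∷ w)
cons-distinct fresh inj {zero}  {zero}  _ = refl
cons-distinct fresh inj {zero}  {suc j} e = ⊥-elim (fresh j (sym e))
cons-distinct fresh inj {suc i} {zero}  e = ⊥-elim (fresh i e)
cons-distinct fresh inj {suc i} {suc j} e = cong suc (inj e)

no-distinct-members : {A : Set} (xs : List A) {n : ℕ} → length xs ≤ n →
                      (w : Fin (suc n) → A) → (∀ i → w i ∈ xs) → ¬ Distinct w
no-distinct-members xs len w w∈ inj
  with i , j , i<j , sameIndex ← pigeonhole (s≤s len) (λ i → index (w∈ i))
  = <ᶠ-irrefl (inj (index-injective (setoid _) (w∈ i) (w∈ j) sameIndex)) i<j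

Between : ℕ → ℕ → ℕ → Set
Between a b c = (a ≤ b × b ≤ c) ⊎ (c ≤ b × b ≤ a)

one-between : ∀ a b c → Between b a c ⊎ Between a b c ⊎ Between a c b
one-between a b c with ≤-total a b | ≤-total b c | ≤-total a c
... | inj₁ a≤b | inj₁ b≤c | _         = inj₂ (inj₁ (inj₁ (a≤b , b≤c)))
... | inj₁ a≤b | inj₂ c≤b | inj₁ a≤c = inj₂ (inj₂ (inj₁ (a≤c , c≤b)))
... | inj₁ a≤b | inj₂ c≤b | inj₂ c≤a = inj₁ (inj₂ (c≤a , a≤b))
... | inj₂ b≤a | _         | inj₁ a≤c = inj₁ (inj₁ (b≤a , a≤c))
... | inj₂ b≤a | inj₁ b≤c | inj₂ c≤a = inj₂ (inj₂ (inj₂ (b≤c , c≤a)))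
... | inj₂ b≤a | inj₂ c≤b | inj₂ _   = inj₂ (inj₁ (inj₂ (c≤b , b≤a)))

Disjoint : {V : Set} → Pred V 0ℓ → Pred V 0ℓ → Set
Disjoint A B = ∀ {y} → A y → B y → ⊥

record ThreeOf {m : ℕ} (P : Fin m → Set) : Set where
  constructor three
  field
    i j k       : Fin m
    i≢j         : i ≢ j
    i≢k         : i ≢ k
    j≢k         : j ≢ k
    Pi          : P i
    Pj          : P j
    Pk          : P k

three-map : ∀ {m} {P Q : Fin m → Set} → (∀ {i} → P i → Q i) → ThreeOf P → ThreeOf Q
three-map f (three i j k i≢j i≢k j≢k Pi Pj Pk) = three i j k i≢j i≢k j≢k (f Pi) (f Pj) (f Pk)

both-other : ∀ {x y z : Bool} → x ≢ z → y ≢ z → x ≡ y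
both-other {false} {false} _ _ = refl
both-other {true}  {true}  _ _ = refl
both-other {false} {true}  {false} x≢z _ = ⊥-elim (x≢z refl)
both-other {false} {true}  {true}  _ y≢z = ⊥-elim (y≢z refl)
both-other {true}  {false} {false} _ y≢z = ⊥-elim (y≢z refl)
both-other {true}  {false} {true}  x≢z _ = ⊥-elim (x≢z refl)

three-alike : (h : Fin 5 → Bool) → ∃ λ β → ThreeOf (λ i → h i ≡ β)
three-alike h with h 0F ≟ᴮ h 1F
... | yes h0≡h1 = with-pair h0≡h1
  where
    with-pair : h 0F ≡ h 1F → ∃ λ β → ThreeOf (λ i → h i ≡ β)
    with-pair e with h 2F ≟ᴮ h 0F | h 3F ≟ᴮ h 0F | h 4F ≟ᴮ h 0F
    ... | yes e2 | _      | _      = h 0F , three 0F 1F 2F (λ ()) (λ ()) (λ ()) refl (sym e) e2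
    ... | no _   | yes e3 | _      = h 0F , three 0F 1F 3F (λ ()) (λ ()) (λ ()) refl (sym e) e3
    ... | no _   | no _   | yes e4 = h 0F , three 0F 1F 4F (λ ()) (λ ()) (λ ()) refl (sym e) e4
    ... | no n2  | no n3  | no n4  = h 2F , three 2F 3F 4F (λ ()) (λ ()) (λ ()) refl (both-other n3 n2) (both-other n4 n2)
... | no h0≢h1 = with-split
  where
    joining : ∀ p q → p ≢ q → 0F ≢ p → 0F ≢ q → 1F ≢ p → 1F ≢ q → h p ≡ h q → ∃ λ β → ThreeOf (λ i → h i ≡ β)
    joining p q p≢q 0≢p 0≢q 1≢p 1≢q e with h 0F ≟ᴮ h p | h 1F ≟ᴮ h p
    ... | yes e0 | _      = h p , three 0F p q 0≢p 0≢q p≢q e0 refl (sym e)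
    ... | no _   | yes e1 = h p , three 1F p q 1≢p 1≢q p≢q e1 refl (sym e)
    ... | no n0  | no n1  = ⊥-elim (h0≢h1 (both-other n0 n1))
    with-split : ∃ λ β → ThreeOf (λ i → h i ≡ β)
    with-split with h 2F ≟ᴮ h 3F | h 2F ≟ᴮ h 4F
    ... | yes e23 | _       = joining 2F 3F (λ ()) (λ ()) (λ ()) (λ ()) (λ ()) e23
    ... | no _    | yes e24 = joining 2F 4F (λ ()) (λ ()) (λ ()) (λ ()) (λ ()) e24
    ... | no n23  | no n24  = joining 3F 4F (λ ()) (λ ()) (λ ()) (λ ()) (λ ()) (both-other (λ e → n23 (sym e)) (λ e → n24 (sym e)))

all-or-escape : ∀ {ℓ} {A B C X : Set ℓ} → A ⊎ X → B ⊎ X → C ⊎ X → (A × B × C) ⊎ X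
all-or-escape (inj₂ x) _        _        = inj₂ x
all-or-escape (inj₁ _) (inj₂ x) _        = inj₂ x
all-or-escape (inj₁ _) (inj₁ _) (inj₂ x) = inj₂ x
all-or-escape (inj₁ a) (inj₁ b) (inj₁ c) = inj₁ (a , b , c)

Image : {S V : Set} → (S → V) → Pred V 0ℓ
Image e y = ∃ λ z → e z ≡ y

Region : {S V : Set} → V → (S → V) → Pred V 0ℓ
Region p e = ｛ p ｝ ∪ Image e

region-mono : ∀ {S T V : Set} {p : V} {e : S → V} (f : T → S) → Region p (λ y → e (f y)) ⊆ Region p e
region-mono f (inj₁ refl)       = inj₁ refl
region-mono f (inj₂ (z , refl)) = inj₂ (f z , refl)

-- A gadget S splits into m pieces: piece i is a centre vertex together with a
-- copy of a smaller gadget T beyond it.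
record Pieces (S T : Set) (m : ℕ) : Set where
  field
    centre           : Fin m → S
    beyond           : Fin m → T → S
    centre-injective : ∀ {i j} → centre i ≡ centre j → i ≡ j
    beyond-injective : ∀ {i j y z} → beyond i y ≡ beyond j z → i ≡ j × y ≡ z
    beyond≢centre    : ∀ {i j y} → beyond i y ≢ centre j

  module _ {V : Set} (e : S → V) where

    piece : Fin m → Pred V 0ℓ
    piece i = Region (e (centre i)) (λ y → e (beyond i y))

    piece⊆image : ∀ {i} → piece i ⊆ Image e
    piece⊆image {i} (inj₁ refl)       = centre i , refl
    piece⊆image {i} (inj₂ (y , refl)) = beyond i y , refl

    pieces-disjoint : Distinct e → ∀ {i j} → i ≢ j → Disjoint (piece i) (piece j)
    pieces-disjoint injective i≢j (inj₁ refl)       (inj₁ e′)      = i≢j (sym (centre-injective (injective e′)))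
    pieces-disjoint injective i≢j (inj₁ refl)       (inj₂ (z , e′)) = beyond≢centre (injective e′)
    pieces-disjoint injective i≢j (inj₂ (y , refl)) (inj₁ e′)      = beyond≢centre (injective (sym e′))
    pieces-disjoint injective i≢j (inj₂ (y , refl)) (inj₂ (z , e′)) = i≢j (sym (proj₁ (beyond-injective (injective e′))))

    copy-injective : Distinct e → ∀ i → Distinct (λ y → e (beyond i y))
    copy-injective injective i e′ = proj₂ (beyond-injective (injective e′))

    copy-avoids-centre : Distinct e → ∀ i y → e (beyond i y) ≢ e (centre i)
    copy-avoids-centre injective i y e′ = beyond≢centre (injective e′)

pullback : {I V : Set} → Graph V → (I → V) → Graph I
pullback G f = record { Adj = λ i j → Adj G (f i) (f j) ; sym = adj-sym G ; irrefl = irrefl G }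

module ColourClasses {V : Set} (G : Graph V) (col : V → Bool) (c : ℕ) where

  -- A path decomposition of width ≤ c of the subgraph induced by the colour
  -- class b, with bags presented as predicates on V.
  record ClassDecomposition (b : Bool) : Set₁ where
    field
      m        : ℕ
      InBag    : Fin m → V → Set
      covers   : ∀ v → col v ≡ b → ∃ λ t → InBag t v
      edges    : ∀ {u w} → Adj G u w → col u ≡ b → col w ≡ b → ∃ λ t → InBag t u × InBag t w
      interval : ∀ {v i j k} → toℕ i ≤ toℕ j → toℕ j ≤ toℕ k → InBag i v → InBag k v → InBag j v
      narrow   : ∀ t (w : Fin (suc (suc c)) → V) → (∀ i → InBag t (w i)) → ¬ Distinct w

module _ {V : Set} (G : Graph V) {N : ℕ} (enc : V ↔ Fin N) (part : Fin N → Bool) (c : ℕ) where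
  open Inverse enc using (to; from; strictlyInverseʳ)
  open ColourClasses G (λ v → part (to v)) c

  to-injective : Distinct to
  to-injective = Injection.injective (Inverse⇒Injection enc)

  classDecomposition : ∀ b → PathDecomposition (induced (pullback G from) (λ v → part v ≡ b)) c →
                       ClassDecomposition b
  classDecomposition b D = record
    { m        = m
    ; InBag    = InBag
    ; covers   = λ v cv → let t , v∈ = covers (to v , cv) in t , cv , v∈
    ; edges    = edges′
    ; interval = interval′
    ; narrow   = λ t w w∈ distinct →
        no-distinct-members (bag t) (width t) (λ i → to (w i) , proj₁ (w∈ i)) (λ i → proj₂ (w∈ i))
          (λ e → distinct (to-injective (cong proj₁ e)))
    }
    where
      open PathDecomposition D
      InBag : Fin m → V → Set
      InBag t y = Σ (part (to y) ≡ b) λ p → (to y , p) ∈ bag t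

      edges′ : ∀ {u w} → Adj G u w → part (to u) ≡ b → part (to w) ≡ b → ∃ λ t → InBag t u × InBag t w
      edges′ {u} {w} a cu cw
        with t , u∈ , w∈ ← edges (to u , cu) (to w , cw)
                                  (subst₂ (Adj G) (sym (strictlyInverseʳ u)) (sym (strictlyInverseʳ w)) a)
        = t , (cu , u∈) , (cw , w∈)

      -- colour evidence is unique (Bool has decidable equality), so bags stay intervals
      interval′ : ∀ {v i j k} → toℕ i ≤ toℕ j → toℕ j ≤ toℕ k → InBag i v → InBag k v → InBag j v
      interval′ {v} {i} {j} {k} i≤j j≤k (p , v∈i) (p′ , v∈k)
        rewrite Decidable⇒UIP.≡-irrelevant _≟ᴮ_ p p′
        = p′ , interval (to v , p′) i j k i≤j j≤k v∈i v∈k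

module Branching {V : Set} (G : Graph V) (col : V → Bool) (c : ℕ)
                 (D : ∀ b → ColourClasses.ClassDecomposition G col c b) where
  open ColourClasses.ClassDecomposition

  data Walk (P : Pred V 0ℓ) : V → V → Set where
    stay : ∀ {u} → P u → Walk P u u
    move : ∀ {u w v} → P u → Adj G u w → Walk P w v → Walk P u v

  weaken : ∀ {P Q u v} → P ⊆ Q → Walk P u v → Walk Q u v
  weaken P⊆Q (stay p)     = stay (P⊆Q p)
  weaken P⊆Q (move p a w) = move (P⊆Q p) a (weaken P⊆Q w)

  _++_ : ∀ {P u v w} → Walk P u v → Walk P v w → Walk P u w
  stay _       ++ w′ = w′
  move p a w   ++ w′ = move p a (w ++ w′)

  first : ∀ {P u v} → Walk P u v → P u
  first (stay p)     = p
  first (move p _ _) = p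

  reverse : ∀ {P u v} → Walk P u v → Walk P v u
  reverse (stay p)     = stay p
  reverse (move p a w) = reverse w ++ move (first w) (adj-sym G a) (stay p)

  crossing : ∀ {b P} → P ⊆ (λ y → col y ≡ b) → ∀ {y y′} → Walk P y y′ →
             ∀ {i j k} → InBag (D b) i y → InBag (D b) k y′ → toℕ i ≤ toℕ j → toℕ j ≤ toℕ k →
             ∃ λ z → P z × InBag (D b) j z
  crossing {b} coloured (stay {u} p) y∈i y′∈k i≤j j≤k = u , p , interval (D b) i≤j j≤k y∈i y′∈k
  crossing {b} coloured (move {u} {w} p a rest) {i} {j} y∈i y′∈k i≤j j≤k
    with t , u∈t , w∈t ← edges (D b) a (coloured p) (coloured (first rest))
    with toℕ j ℕ.≤? toℕ t
  ... | yes j≤t = u , p , interval (D b) i≤j j≤t y∈i u∈t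
  ... | no  j≰t = crossing coloured rest w∈t y′∈k (<⇒≤ (≰⇒> j≰t)) j≤k

  crossing-between : ∀ {b P} → P ⊆ (λ y → col y ≡ b) → ∀ {y y′} → Walk P y y′ →
                     ∀ {i j k} → InBag (D b) i y → InBag (D b) k y′ → Between (toℕ i) (toℕ j) (toℕ k) →
                     ∃ λ z → P z × InBag (D b) j z
  crossing-between coloured w y∈i y′∈k (inj₁ (i≤j , j≤k)) = crossing coloured w y∈i y′∈k i≤j j≤k
  crossing-between coloured w y∈i y′∈k (inj₂ (k≤j , j≤i)) = crossing coloured (reverse w) y′∈k y∈i k≤j j≤i

  record Cluster (b : Bool) (A : Pred V 0ℓ) (x : V) : Set where
    field
      contains  : A x
      coloured  : A ⊆ (λ y → col y ≡ b)
      connected : ∀ {y} → A y → Walk A y x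

  record Wide (b : Bool) (A : Pred V 0ℓ) (k : ℕ) : Set where
    field
      bag      : Fin (m (D b))
      members  : Fin (suc k) → V
      distinct : Distinct members
      inSet    : ∀ i → A (members i)
      inBag    : ∀ i → InBag (D b) bag (members i)

  -- Bags have at most c+1 vertices.
  not-wide : ∀ {b A} → ¬ Wide b A (suc c)
  not-wide {b} W = narrow (D b) bag members inBag distinct
    where open Wide W

  Rooted : Bool → Pred V 0ℓ → V → ℕ → Set
  Rooted b A x k = Cluster b A x × Wide b A k

  singleton : ∀ x → Rooted (col x) ｛ x ｝ x 0
  singleton x with t , x∈t ← covers (D (col x)) x refl =
      record { contains = refl ; coloured = λ { refl → refl } ; connected = λ { refl → stay refl } }
    , record { bag = t ; members = λ _ → x ; distinct = λ { {zero} {zero} _ → refl }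
             ; inSet = λ _ → refl ; inBag = λ _ → x∈t }

  RootedIn : Bool → Pred V 0ℓ → V → ℕ → Set₁
  RootedIn b R x k = Σ (Pred V 0ℓ) λ A → Rooted b A x k × A ⊆ R

  record Arm (b : Bool) (x : V) (R : Pred V 0ℓ) (k : ℕ) : Set₁ where
    field
      root     : V
      set      : Pred V 0ℓ
      rooted   : Rooted b set root k
      within   : set ⊆ R
      adjacent : Adj G x root

    cluster : Cluster b set root
    cluster = proj₁ rooted

    wide : Wide b set k
    wide = proj₂ rooted

    walk-to-centre : ∀ {U : Pred V 0ℓ} → U x → set ⊆ U → ∀ {y} → set y → Walk U y x
    walk-to-centre x∈U set⊆U y∈set =
      weaken set⊆U (Cluster.connected cluster y∈set)
        ++ move (set⊆U (Cluster.contains cluster)) (adj-sym G adjacent) (stay x∈U)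

  open Arm

  -- If the bag of arm l lies between the bags of arms i and j, then the walk
  -- i → x → j meets the bag of l outside l, which therefore holds k+2 vertices
  -- of the union U.
  wide-middle : ∀ {b x k Rᵢ Rⱼ Rₗ} {U : Pred V 0ℓ} (Aᵢ : Arm b x Rᵢ k) (Aⱼ : Arm b x Rⱼ k) (Aₗ : Arm b x Rₗ k) →
                col x ≡ b → U x → set Aᵢ ⊆ U → set Aⱼ ⊆ U → set Aₗ ⊆ U →
                x ∉ set Aₗ → Disjoint (set Aᵢ) (set Aₗ) → Disjoint (set Aⱼ) (set Aₗ) →
                Between (toℕ (Wide.bag (wide Aᵢ))) (toℕ (Wide.bag (wide Aₗ))) (toℕ (Wide.bag (wide Aⱼ))) →
                Wide b U (suc k)
  wide-middle {b} {x} {U = U} Aᵢ Aⱼ Aₗ cx x∈U i⊆U j⊆U l⊆U x∉l i#l j#l between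
    = record { bag = Wide.bag (wide Aₗ)
             ; members = z ∷ Wide.members (wide Aₗ)
             ; distinct = cons-distinct (λ i e → C∉l z∈C (subst (set Aₗ) e (Wide.inSet (wide Aₗ) i)))
                                        (Wide.distinct (wide Aₗ))
             ; inSet = λ { zero → C⊆U z∈C ; (suc i) → l⊆U (Wide.inSet (wide Aₗ) i) }
             ; inBag = λ { zero → z∈bag ; (suc i) → Wide.inBag (wide Aₗ) i } }
    where
      C : Pred V 0ℓ
      C = ｛ x ｝ ∪ set Aᵢ ∪ set Aⱼ
      C⊆U : C ⊆ U
      C⊆U (inj₁ refl)        = x∈U
      C⊆U (inj₂ (inj₁ y∈i)) = i⊆U y∈i
      C⊆U (inj₂ (inj₂ y∈j)) = j⊆U y∈j
      coloured : C ⊆ (λ y → col y ≡ b)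
      coloured (inj₁ refl)        = cx
      coloured (inj₂ (inj₁ y∈i)) = Cluster.coloured (cluster Aᵢ) y∈i
      coloured (inj₂ (inj₂ y∈j)) = Cluster.coloured (cluster Aⱼ) y∈j
      walk : Walk C (Wide.members (wide Aᵢ) zero) (Wide.members (wide Aⱼ) zero)
      walk = walk-to-centre Aᵢ (inj₁ refl) (λ y∈i → inj₂ (inj₁ y∈i)) (Wide.inSet (wide Aᵢ) zero)
          ++ reverse (walk-to-centre Aⱼ (inj₁ refl) (λ y∈j → inj₂ (inj₂ y∈j)) (Wide.inSet (wide Aⱼ) zero))
      crossed : ∃ λ z → C z × InBag (D b) (Wide.bag (wide Aₗ)) z
      crossed = crossing-between coloured walk (Wide.inBag (wide Aᵢ) zero) (Wide.inBag (wide Aⱼ) zero) between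
      z = proj₁ crossed
      z∈C = proj₁ (proj₂ crossed)
      z∈bag = proj₂ (proj₂ crossed)
      C∉l : ∀ {y} → C y → y ∉ set Aₗ
      C∉l (inj₁ refl)        = x∉l
      C∉l (inj₂ (inj₁ y∈i)) = i#l y∈i
      C∉l (inj₂ (inj₂ y∈j)) = j#l y∈j

  branching : ∀ {b x k} {R₁ R₂ R₃ : Pred V 0ℓ} → col x ≡ b →
              x ∉ R₁ → x ∉ R₂ → x ∉ R₃ → Disjoint R₁ R₂ → Disjoint R₁ R₃ → Disjoint R₂ R₃ →
              Arm b x R₁ k → Arm b x R₂ k → Arm b x R₃ k → RootedIn b (｛ x ｝ ∪ R₁ ∪ R₂ ∪ R₃) x (suc k)
  branching {b} {x} cx x∉R₁ x∉R₂ x∉R₃ R₁#R₂ R₁#R₃ R₂#R₃ A₁ A₂ A₃ = U , (cluster′ , wide′) , U⊆R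
    where
      U : Pred V 0ℓ
      U = ｛ x ｝ ∪ set A₁ ∪ set A₂ ∪ set A₃
      U⊆R : U ⊆ ｛ x ｝ ∪ _ ∪ _ ∪ _
      U⊆R (inj₁ refl)                = inj₁ refl
      U⊆R (inj₂ (inj₁ y∈₁))         = inj₂ (inj₁ (within A₁ y∈₁))
      U⊆R (inj₂ (inj₂ (inj₁ y∈₂))) = inj₂ (inj₂ (inj₁ (within A₂ y∈₂)))
      U⊆R (inj₂ (inj₂ (inj₂ y∈₃))) = inj₂ (inj₂ (inj₂ (within A₃ y∈₃)))

      ⊆U₁ : set A₁ ⊆ U
      ⊆U₁ = λ y∈ → inj₂ (inj₁ y∈)
      ⊆U₂ : set A₂ ⊆ U
      ⊆U₂ = λ y∈ → inj₂ (inj₂ (inj₁ y∈))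
      ⊆U₃ : set A₃ ⊆ U
      ⊆U₃ = λ y∈ → inj₂ (inj₂ (inj₂ y∈))

      cluster′ : Cluster b U x
      cluster′ = record { contains = inj₁ refl ; coloured = coloured ; connected = connected }
        where
          coloured : U ⊆ (λ y → col y ≡ b)
          coloured (inj₁ refl)                = cx
          coloured (inj₂ (inj₁ y∈₁))         = Cluster.coloured (cluster A₁) y∈₁
          coloured (inj₂ (inj₂ (inj₁ y∈₂))) = Cluster.coloured (cluster A₂) y∈₂
          coloured (inj₂ (inj₂ (inj₂ y∈₃))) = Cluster.coloured (cluster A₃) y∈₃
          connected : ∀ {y} → U y → Walk U y x
          connected (inj₁ refl)                = stay (inj₁ refl)
          connected (inj₂ (inj₁ y∈₁))         = walk-to-centre A₁ (inj₁ refl) ⊆U₁ y∈₁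
          connected (inj₂ (inj₂ (inj₁ y∈₂))) = walk-to-centre A₂ (inj₁ refl) ⊆U₂ y∈₂
          connected (inj₂ (inj₂ (inj₂ y∈₃))) = walk-to-centre A₃ (inj₁ refl) ⊆U₃ y∈₃

      x∉ : ∀ {R} (A : Arm b x R _) → x ∉ R → x ∉ set A
      x∉ A x∉R x∈ = x∉R (within A x∈)
      apart : ∀ {R R′} (A : Arm b x R _) (A′ : Arm b x R′ _) → Disjoint R R′ → Disjoint (set A) (set A′)
      apart A A′ R#R′ y∈ y∈′ = R#R′ (within A y∈) (within A′ y∈′)

      bagOf : ∀ {R} → Arm b x R _ → ℕ
      bagOf A = toℕ (Wide.bag (wide A))

      wide′ : Wide b U (suc _)
      wide′ with one-between (bagOf A₁) (bagOf A₂) (bagOf A₃)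
      ... | inj₁ between =
        wide-middle A₂ A₃ A₁ cx (inj₁ refl) ⊆U₂ ⊆U₃ ⊆U₁ (x∉ A₁ x∉R₁)
          (apart A₂ A₁ λ p q → R₁#R₂ q p) (apart A₃ A₁ λ p q → R₁#R₃ q p) between
      ... | inj₂ (inj₁ between) =
        wide-middle A₁ A₃ A₂ cx (inj₁ refl) ⊆U₁ ⊆U₃ ⊆U₂ (x∉ A₂ x∉R₂)
          (apart A₁ A₂ R₁#R₂) (apart A₃ A₂ λ p q → R₂#R₃ q p) between
      ... | inj₂ (inj₂ between) =
        wide-middle A₁ A₂ A₃ cx (inj₁ refl) ⊆U₁ ⊆U₂ ⊆U₃ (x∉ A₃ x∉R₃)
          (apart A₁ A₃ R₁#R₃) (apart A₂ A₃ R₂#R₃) between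

maximum : ∀ {n} → (Fin n → ℕ) → ℕ
maximum {zero}  f = 0
maximum {suc n} f = f zero ⊔ maximum (λ i → f (suc i))

≤-maximum : ∀ {n} (f : Fin n → ℕ) i → f i ≤ maximum f
≤-maximum f zero    = ℕ.m≤m⊔n (f zero) _
≤-maximum f (suc i) = ≤-trans (≤-maximum (λ i → f (suc i)) i) (ℕ.m≤n⊔m (f zero) _)

-- Graphs with a 2-elimination ordering have no K4 minor.  Deleting the
-- vertex of highest rank from a K4 model leaves a K4 model (a walk through it
-- can bypass it, and an edge at it can be moved to its lower neighbour in its
-- own branch set), unless it forms a branch set on its own; then its edges to
-- the three other branch sets give it three distinct lower neighbours.
module EliminationOrdering {n : ℕ} (G : Graph (Fin n)) (rank : Fin n → ℕ) (rank-injective : Distinct rank)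
  (lower-adjacent : ∀ {w s z} → Adj G w s → Adj G w z → rank s < rank w → rank z < rank w → s ≡ z ⊎ Adj G s z)
  (lower-at-most-two : ∀ {w x y z} → Adj G w x → Adj G w y → Adj G w z →
                       rank x < rank w → rank y < rank w → rank z < rank w → x ≡ y ⊎ x ≡ z ⊎ y ≡ z) where
  open K4Model

  Below : K4Model G → ℕ → Set
  Below M k = ∀ {v i} → β M v ≡ just i → rank v < k

  one-branch : ∀ {x : Maybe (Fin 4)} {i j} → x ≡ just i → x ≡ just j → i ≡ j
  one-branch refl refl = refl

  predecessor : ∀ {P s t} → WalkIn G P s t → P s → s ≢ t → ∃ λ y → P y × y ≢ t × Adj G y t
  predecessor here ps s≢t = ⊥-elim (s≢t refl)
  predecessor {s = s} {t} (step {w = u} a pu rest) ps s≢t with u ≟ᶠ t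
  ... | yes refl = s , ps , s≢t , a
  ... | no u≢t   = predecessor rest pu u≢t

  module Delete (M : K4Model G) (k : ℕ) (below : Below M (suc k))
                (w : Fin n) (i : Fin 4) (rank-w : rank w ≡ k) (w∈i : β M w ≡ just i) where

    lower : ∀ {v j} → β M v ≡ just j → v ≢ w → rank v < rank w
    lower v∈j v≢w = subst (_ <_) (sym rank-w)
      (ℕ.≤∧≢⇒< (s≤s⁻¹ (below v∈j)) (λ e → v≢w (rank-injective (trans e (sym rank-w)))))

    lower-neighbour : ∀ {v j} → Adj G w v → β M v ≡ just j → rank v < rank w
    lower-neighbour a v∈j = lower v∈j λ { refl → irrefl G a }

    β′ : Fin n → Maybe (Fin 4)
    β′ v with v ≟ᶠ w
    ... | yes _ = nothing
    ... | no  _ = β M v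

    keep : ∀ {v} → v ≢ w → β′ v ≡ β M v
    keep {v} v≢w with v ≟ᶠ w
    ... | yes v≡w = ⊥-elim (v≢w v≡w)
    ... | no  _   = refl

    kept : ∀ {v j} → β′ v ≡ just j → v ≢ w × β M v ≡ just j
    kept {v} v∈j with v ≟ᶠ w
    ... | no v≢w = v≢w , v∈j

    below′ : ∀ {v j} → β′ v ≡ just j → rank v < k
    below′ v∈j = let v≢w , v∈j = kept v∈j in subst (_ <_) rank-w (lower v∈j v≢w)

    -- If w is alone in its branch set, its edges to the other three branch
    -- sets end in three distinct lower neighbours.
    not-alone : ¬ (∃ λ x → β′ x ≡ just i) → ⊥
    not-alone alone =
      distinct-endpoints (lower-at-most-two (to 0F) (to 1F) (to 2F) (rank-below 0F) (rank-below 1F) (rank-below 2F))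
      where
        edge : ∀ l → ∃ λ v → β M v ≡ just (punchIn i l) × Adj G w v
        edge l with u , v , u∈i , v∈l , a ← adjacent M i (punchIn i l) (λ e → punchInᵢ≢i i l (sym e))
                  with u ≟ᶠ w
        ... | yes refl = v , v∈l , a
        ... | no u≢w   = ⊥-elim (alone (u , trans (keep u≢w) u∈i))
        endpoint : Fin 3 → Fin n
        endpoint l = proj₁ (edge l)
        to : ∀ l → Adj G w (endpoint l)
        to l = proj₂ (proj₂ (edge l))
        rank-below : ∀ l → rank (endpoint l) < rank w
        rank-below l = lower-neighbour (to l) (proj₁ (proj₂ (edge l)))
        separate : ∀ {l l′} → endpoint l ≡ endpoint l′ → l ≡ l′
        separate {l} {l′} e = punchIn-injective i l l′
          (one-branch (proj₁ (proj₂ (edge l))) (subst (λ v → β M v ≡ _) (sym e) (proj₁ (proj₂ (edge l′)))))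
        distinct-endpoints : endpoint 0F ≡ endpoint 1F ⊎ endpoint 0F ≡ endpoint 2F ⊎ endpoint 1F ≡ endpoint 2F → ⊥
        distinct-endpoints (inj₁ e)        = case separate e of λ ()
        distinct-endpoints (inj₂ (inj₁ e)) = case separate e of λ ()
        distinct-endpoints (inj₂ (inj₂ e)) = case separate e of λ ()

    -- Walks inside a branch set bypass w: its two neighbours on the walk are
    -- lower neighbours of w, hence equal or adjacent.
    bypass : ∀ {j s t} → β M s ≡ just j → s ≢ w → t ≢ w →
             WalkIn G (λ v → β M v ≡ just j) s t → WalkIn G (λ v → β′ v ≡ just j) s t
    bypass s∈j s≢w t≢w here = here
    bypass {j} {s} {t} s∈j s≢w t≢w (step {w = u} a u∈j rest) with u ≟ᶠ w
    ... | no u≢w   = step a (trans (keep u≢w) u∈j) (bypass u∈j u≢w t≢w rest)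
    ... | yes refl = skip rest
      where
        skip : WalkIn G (λ v → β M v ≡ just j) w t → WalkIn G (λ v → β′ v ≡ just j) s t
        skip here = ⊥-elim (t≢w refl)
        skip (step {w = z} a′ z∈j rest′)
          with lower-adjacent (adj-sym G a) a′ (lower s∈j s≢w) (lower-neighbour a′ z∈j)
        ... | inj₁ refl = bypass z∈j s≢w t≢w rest′
        ... | inj₂ s~z  = step s~z (trans (keep z≢w) z∈j) (bypass z∈j z≢w t≢w rest′)
          where
            z≢w : z ≢ w
            z≢w refl = irrefl G a′

    module Survivor (x : Fin n) (x∈i′ : β′ x ≡ just i) where
      x≢w : x ≢ w
      x≢w = proj₁ (kept x∈i′)
      x∈i : β M x ≡ just i
      x∈i = proj₂ (kept x∈i′)

      last-step : ∃ λ y → β M y ≡ just i × y ≢ w × Adj G y w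
      last-step = predecessor (connected M i x w x∈i w∈i) x∈i x≢w
      y : Fin n
      y = proj₁ last-step
      y∈i : β M y ≡ just i
      y∈i = proj₁ (proj₂ last-step)
      y≢w : y ≢ w
      y≢w = proj₁ (proj₂ (proj₂ last-step))
      w~y : Adj G w y
      w~y = adj-sym G (proj₂ (proj₂ (proj₂ last-step)))

      move-edge : ∀ {v j} → i ≢ j → β M v ≡ just j → Adj G w v → Adj G y v
      move-edge {v} i≢j v∈j w~v with lower-adjacent w~y w~v (lower y∈i y≢w) (lower-neighbour w~v v∈j)
      ... | inj₁ refl  = ⊥-elim (i≢j (one-branch y∈i v∈j))
      ... | inj₂ y~v   = y~v

      nonempty′ : ∀ j → ∃ λ v → β′ v ≡ just j
      nonempty′ j with j ≟ᶠ i
      ... | yes refl = x , x∈i′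
      ... | no j≢i   = let v , v∈j = nonempty M j
                           v≢w   = λ { refl → j≢i (one-branch v∈j w∈i) }
                       in v , trans (keep v≢w) v∈j

      connected′ : ∀ j u v → β′ u ≡ just j → β′ v ≡ just j → WalkIn G (λ z → β′ z ≡ just j) u v
      connected′ j u v u∈j v∈j =
        let u≢w , u∈j = kept u∈j ; v≢w , v∈j = kept v∈j
        in bypass u∈j u≢w v≢w (connected M j u v u∈j v∈j)

      adjacent′ : ∀ j j′ → j ≢ j′ → ∃ λ u → ∃ λ v → β′ u ≡ just j × β′ v ≡ just j′ × Adj G u v
      adjacent′ j j′ j≢j′ with u , v , u∈j , v∈j′ , u~v ← adjacent M j j′ j≢j′ | u ≟ᶠ w | v ≟ᶠ w
      ... | yes refl | yes refl = ⊥-elim (irrefl G u~v)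
      ... | no u≢w   | no v≢w   = u , v , trans (keep u≢w) u∈j , trans (keep v≢w) v∈j′ , u~v
      ... | yes refl | no v≢w   with refl ← one-branch u∈j w∈i =
        y , v , trans (keep y≢w) y∈i , trans (keep v≢w) v∈j′ , move-edge j≢j′ v∈j′ u~v
      ... | no u≢w   | yes refl with refl ← one-branch v∈j′ w∈i =
        u , y , trans (keep u≢w) u∈j , trans (keep y≢w) y∈i ,
        adj-sym G (move-edge (λ e → j≢j′ (sym e)) u∈j (adj-sym G u~v))

      model : K4Model G
      model = record { β = β′ ; nonempty = nonempty′ ; connected = connected′ ; adjacent = adjacent′ }

    smaller : Σ (K4Model G) λ M′ → Below M′ k
    smaller with any? (λ x → Data.Maybe.Properties.≡-dec _≟ᶠ_ (β′ x) (just i))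
    ... | yes (x , x∈i′) = Survivor.model x x∈i′ , below′
    ... | no alone       = ⊥-elim (not-alone alone)

  no-model : ∀ k (M : K4Model G) → Below M k → ⊥
  no-model zero    M below = ℕ.n≮0 (below (proj₂ (nonempty M zero)))
  no-model (suc k) M below with any? top?
    where
      top? : ∀ w → Dec (rank w ≡ k × ∃ λ i → β M w ≡ just i)
      top? w with rank w ℕ.≟ k | β M w
      ... | yes e | just i  = yes (e , i , refl)
      ... | yes _ | nothing = no λ { (_ , _ , ()) }
      ... | no ne | _       = no λ (e , _) → ne e
  ... | yes (w , rank-w , i , w∈i) = let M′ , below′ = Delete.smaller M k below w i rank-w w∈i in no-model k M′ below′
  ... | no no-top = no-model k M λ {v} {i} v∈i →
          ℕ.≤∧≢⇒< (s≤s⁻¹ (below v∈i)) (λ e → no-top (v , e , i , v∈i))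

  series-parallel : SeriesParallel G
  series-parallel M = no-model (suc (maximum rank)) M λ {v} _ → s≤s (≤-maximum rank v)

data Parents (X : Set) : Set where
  none : Parents X
  one  : X → Parents X
  two  : X → X → Parents X

_∈ₚ_ : {X : Set} → X → Parents X → Set
y ∈ₚ none    = ⊥
y ∈ₚ one p   = y ≡ p
y ∈ₚ two p q = y ≡ p ⊎ y ≡ q

Linked : {V : Set} → (V → Parents V) → V → V → Set
Linked parents x y = x ∈ₚ parents y ⊎ y ∈ₚ parents x

module ParentGraph {V : Set} (parents : V → Parents V) (depth : V → ℕ)
  (shallower : ∀ {p x} → p ∈ₚ parents x → depth p < depth x)
  (linked-parents : ∀ {x p q} → parents x ≡ two p q → Linked parents p q) where

  graph : Graph V
  graph = record { Adj = Linked parents ; sym = swap ; irrefl = no-loop }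
    where
      swap : ∀ {x y} → Linked parents x y → Linked parents y x
      swap (inj₁ p) = inj₂ p
      swap (inj₂ p) = inj₁ p
      no-loop : ∀ {x} → ¬ Linked parents x x
      no-loop (inj₁ p) = ℕ.<-irrefl refl (shallower p)
      no-loop (inj₂ p) = ℕ.<-irrefl refl (shallower p)

  parents-linked : ∀ {w x y} → x ∈ₚ parents w → y ∈ₚ parents w → x ≡ y ⊎ Linked parents x y
  parents-linked {w} x∈ y∈ = go (parents w) refl x∈ y∈
    where
      go : ∀ ps → parents w ≡ ps → ∀ {x y} → x ∈ₚ ps → y ∈ₚ ps → x ≡ y ⊎ Linked parents x y
      go none      _ ()
      go (one p)   _ refl refl               = inj₁ refl
      go (two p q) _ (inj₁ refl) (inj₁ refl) = inj₁ refl
      go (two p q) _ (inj₂ refl) (inj₂ refl) = inj₁ refl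
      go (two p q) e (inj₁ refl) (inj₂ refl) = inj₂ (linked-parents e)
      go (two p q) e (inj₂ refl) (inj₁ refl) = inj₂ (adj-sym graph (linked-parents e))

  parents-at-most-two : ∀ {w x y z} → x ∈ₚ parents w → y ∈ₚ parents w → z ∈ₚ parents w → x ≡ y ⊎ x ≡ z ⊎ y ≡ z
  parents-at-most-two {w} = go (parents w)
    where
      go : ∀ ps {x y z} → x ∈ₚ ps → y ∈ₚ ps → z ∈ₚ ps → x ≡ y ⊎ x ≡ z ⊎ y ≡ z
      go none ()
      go (one p)   refl refl _                          = inj₁ refl
      go (two p q) (inj₁ refl) (inj₁ refl) _            = inj₁ refl
      go (two p q) (inj₂ refl) (inj₂ refl) _            = inj₁ refl
      go (two p q) (inj₁ refl) (inj₂ refl) (inj₁ refl) = inj₂ (inj₁ refl)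
      go (two p q) (inj₁ refl) (inj₂ refl) (inj₂ refl) = inj₂ (inj₂ refl)
      go (two p q) (inj₂ refl) (inj₁ refl) (inj₁ refl) = inj₂ (inj₂ refl)
      go (two p q) (inj₂ refl) (inj₁ refl) (inj₂ refl) = inj₂ (inj₁ refl)

  lower-is-parent : ∀ {w s} → Linked parents w s → depth s < depth w → s ∈ₚ parents w
  lower-is-parent (inj₂ s∈) _ = s∈
  lower-is-parent (inj₁ w∈) s<w = ⊥-elim (ℕ.<-asym s<w (shallower w∈))

  linked-depths-differ : ∀ {u w} → Linked parents u w → depth u ≢ depth w
  linked-depths-differ (inj₁ u∈) e = ℕ.<-irrefl e (shallower u∈)
  linked-depths-differ (inj₂ w∈) e = ℕ.<-irrefl (sym e) (shallower w∈)

  module OnFin {N : ℕ} (enc : V ↔ Fin N) where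
    open Inverse enc using (to; from; strictlyInverseˡ)

    graphFin : Graph (Fin N)
    graphFin = pullback graph from

    -- the rank orders vertices by depth, ties broken by index
    from-injective : Distinct from
    from-injective {i} {j} e = trans (sym (strictlyInverseˡ i)) (trans (cong to e) (strictlyInverseˡ j))

    rank : Fin N → ℕ
    rank i = toℕ i + depth (from i) * N

    rank-monotone : ∀ {i j} → depth (from i) < depth (from j) → rank i < rank j
    rank-monotone {i} {j} deeper = begin-strict
      toℕ i + depth (from i) * N   <⟨ ℕ.+-monoˡ-< (depth (from i) * N) (toℕ<n i) ⟩
      suc (depth (from i)) * N     ≤⟨ ℕ.*-monoˡ-≤ N deeper ⟩
      depth (from j) * N           ≤⟨ ℕ.m≤n+m _ (toℕ j) ⟩
      rank j                       ∎
      where open ℕ.≤-Reasoning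

    rank-injective : Distinct rank
    rank-injective {i} {j} e with ℕ.<-cmp (depth (from i)) (depth (from j))
    ... | tri< i<j _ _ = ⊥-elim (ℕ.<-irrefl e (rank-monotone i<j))
    ... | tri> _ _ j<i = ⊥-elim (ℕ.<-irrefl (sym e) (rank-monotone j<i))
    ... | tri≈ _ same _ = toℕ-injective (ℕ.+-cancelʳ-≡ _ (toℕ i) (toℕ j) (subst (λ d → toℕ i + d * N ≡ rank j) same e))

    lower-parent : ∀ {w s} → Adj graphFin w s → rank s < rank w → from s ∈ₚ parents (from w)
    lower-parent {w} {s} w~s s<w with ℕ.<-cmp (depth (from s)) (depth (from w))
    ... | tri< lower _ _ = lower-is-parent w~s lower
    ... | tri≈ _ same _  = ⊥-elim (linked-depths-differ w~s (sym same))
    ... | tri> _ _ w<s   = ⊥-elim (ℕ.<-asym s<w (rank-monotone w<s))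

    series-parallel : SeriesParallel graphFin
    series-parallel = EliminationOrdering.series-parallel graphFin rank rank-injective lower-adjacent lower-at-most-two
      where
        lower-adjacent : ∀ {w s z} → Adj graphFin w s → Adj graphFin w z → rank s < rank w → rank z < rank w →
                         s ≡ z ⊎ Adj graphFin s z
        lower-adjacent w~s w~z s<w z<w with parents-linked (lower-parent w~s s<w) (lower-parent w~z z<w)
        ... | inj₁ e      = inj₁ (from-injective e)
        ... | inj₂ linked = inj₂ linked
        lower-at-most-two : ∀ {w x y z} → Adj graphFin w x → Adj graphFin w y → Adj graphFin w z →
                            rank x < rank w → rank y < rank w → rank z < rank w → x ≡ y ⊎ x ≡ z ⊎ y ≡ z
        lower-at-most-two w~x w~y w~z x<w y<w z<w
          with parents-at-most-two (lower-parent w~x x<w) (lower-parent w~y y<w) (lower-parent w~z z<w)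
        ... | inj₁ e        = inj₁ (from-injective e)
        ... | inj₂ (inj₁ e) = inj₂ (inj₁ (from-injective e))
        ... | inj₂ (inj₂ e) = inj₂ (inj₂ (from-injective e))

-- The gadget attached to an edge uv, with budgets a (for u) and b (for v):
-- five apexes adjacent to both u and v, and recursively a gadget on the edge
-- from each apex to v (budgets a-1, b) and on the edge from u to each apex
-- (budgets a, b-1).
data Diamond : ℕ → ℕ → Set where
  apex        : ∀ {a b} → Fin 5 → Diamond (suc a) (suc b)
  onRightEdge : ∀ {a b} → Fin 5 → Diamond a (suc b) → Diamond (suc a) (suc b)
  onLeftEdge  : ∀ {a b} → Fin 5 → Diamond (suc a) b → Diamond (suc a) (suc b)

-- A ternary tree of height h whose edges (from a node to a child) each carry
-- a gadget Diamond H H.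
data Tree (H : ℕ) : ℕ → Set where
  child   : ∀ {h} → Fin 3 → Tree H (suc h)
  inside  : ∀ {h} → Fin 3 → Tree H h → Tree H (suc h)
  onEdge  : ∀ {h} → Fin 3 → Diamond H H → Tree H (suc h)

diamondParents : ∀ {X : Set} {a b} → X → X → (Diamond a b → X) → Diamond a b → Parents X
diamondParents u v e (apex i)          = two u v
diamondParents u v e (onRightEdge i x) = diamondParents (e (apex i)) v (λ y → e (onRightEdge i y)) x
diamondParents u v e (onLeftEdge i x)  = diamondParents u (e (apex i)) (λ y → e (onLeftEdge i y)) x

diamondDepth : ∀ {a b} → ℕ → Diamond a b → ℕ
diamondDepth L (apex i)          = L
diamondDepth L (onRightEdge i x) = diamondDepth (suc L) x
diamondDepth L (onLeftEdge i x)  = diamondDepth (suc L) x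

treeParents : ∀ {X : Set} {H h} → X → (Tree H h → X) → Tree H h → Parents X
treeParents r e (child i)    = one r
treeParents r e (inside i x) = treeParents (e (child i)) (λ y → e (inside i y)) x
treeParents r e (onEdge i x) = diamondParents r (e (child i)) (λ y → e (onEdge i y)) x

treeDepth : ∀ {H h} → ℕ → Tree H h → ℕ
treeDepth L (child i)    = L
treeDepth L (inside i x) = treeDepth (suc L) x
treeDepth L (onEdge i x) = diamondDepth (suc L) x

count-branches : ∀ {A B : Set} k {m n} → A ↔ Fin m → B ↔ Fin n → (Fin k × (Fin 1 ⊎ (A ⊎ B))) ↔ Fin (k * (1 + (m + n)))
count-branches {A} {B} k {m} {n} α β = begin
  (Fin k × (Fin 1 ⊎ (A ⊎ B)))         ↔⟨ ↔-refl ×-↔ (↔-refl ⊎-↔ (α ⊎-↔ β)) ⟩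
  (Fin k × (Fin 1 ⊎ (Fin m ⊎ Fin n))) ↔⟨ ↔-refl ×-↔ (↔-refl ⊎-↔ ↔-sym +↔⊎) ⟩
  (Fin k × (Fin 1 ⊎ Fin (m + n)))     ↔⟨ ↔-refl ×-↔ ↔-sym +↔⊎ ⟩
  (Fin k × Fin (1 + (m + n)))         ↔⟨ ↔-sym *↔× ⟩
  Fin (k * (1 + (m + n)))             ∎
  where open EquationalReasoning

empty↔ : {A : Set} → ¬ A → A ↔ Fin 0
empty↔ ¬a = mk↔ₛ′ (λ a → ⊥-elim (¬a a)) (λ ()) (λ ()) (λ a → ⊥-elim (¬a a))

diamond-unfold : ∀ {a b} → Diamond (suc a) (suc b) ↔ (Fin 5 × (Fin 1 ⊎ (Diamond a (suc b) ⊎ Diamond (suc a) b)))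
diamond-unfold = mk↔ₛ′ split join split-join join-split
  where
    split : Diamond (suc _) (suc _) → Fin 5 × (Fin 1 ⊎ (Diamond _ (suc _) ⊎ Diamond (suc _) _))
    split (apex i)          = i , inj₁ zero
    split (onRightEdge i x) = i , inj₂ (inj₁ x)
    split (onLeftEdge i x)  = i , inj₂ (inj₂ x)
    join : Fin 5 × (Fin 1 ⊎ (Diamond _ (suc _) ⊎ Diamond (suc _) _)) → Diamond (suc _) (suc _)
    join (i , inj₁ zero)     = apex i
    join (i , inj₂ (inj₁ x)) = onRightEdge i x
    join (i , inj₂ (inj₂ x)) = onLeftEdge i x
    split-join : ∀ y → split (join y) ≡ y
    split-join (i , inj₁ zero)     = refl
    split-join (i , inj₂ (inj₁ x)) = refl
    split-join (i , inj₂ (inj₂ x)) = refl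
    join-split : ∀ x → join (split x) ≡ x
    join-split (apex i)          = refl
    join-split (onRightEdge i x) = refl
    join-split (onLeftEdge i x)  = refl

tree-unfold : ∀ {H h} → Tree H (suc h) ↔ (Fin 3 × (Fin 1 ⊎ (Tree H h ⊎ Diamond H H)))
tree-unfold = mk↔ₛ′ split join split-join join-split
  where
    split : Tree _ (suc _) → Fin 3 × (Fin 1 ⊎ (Tree _ _ ⊎ Diamond _ _))
    split (child i)    = i , inj₁ zero
    split (inside i x) = i , inj₂ (inj₁ x)
    split (onEdge i x) = i , inj₂ (inj₂ x)
    join : Fin 3 × (Fin 1 ⊎ (Tree _ _ ⊎ Diamond _ _)) → Tree _ (suc _)
    join (i , inj₁ zero)     = child i
    join (i , inj₂ (inj₁ x)) = inside i x
    join (i , inj₂ (inj₂ x)) = onEdge i x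
    split-join : ∀ y → split (join y) ≡ y
    split-join (i , inj₁ zero)     = refl
    split-join (i , inj₂ (inj₁ x)) = refl
    split-join (i , inj₂ (inj₂ x)) = refl
    join-split : ∀ x → join (split x) ≡ x
    join-split (child i)    = refl
    join-split (inside i x) = refl
    join-split (onEdge i x) = refl

diamondSize : ℕ → ℕ → ℕ
diamondSize zero    b       = 0
diamondSize (suc a) zero    = 0
diamondSize (suc a) (suc b) = 5 * (1 + (diamondSize a (suc b) + diamondSize (suc a) b))

diamond↔ : ∀ a b → Diamond a b ↔ Fin (diamondSize a b)
diamond↔ zero    b       = empty↔ λ ()
diamond↔ (suc a) zero    = empty↔ λ ()
diamond↔ (suc a) (suc b) = ↔-trans diamond-unfold (count-branches 5 (diamond↔ a (suc b)) (diamond↔ (suc a) b))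

treeSize : ℕ → ℕ → ℕ
treeSize H zero    = 0
treeSize H (suc h) = 3 * (1 + (treeSize H h + diamondSize H H))

tree↔ : ∀ H h → Tree H h ↔ Fin (treeSize H h)
tree↔ H zero    = empty↔ λ ()
tree↔ H (suc h) = ↔-trans tree-unfold (count-branches 3 (tree↔ H h) (diamond↔ H H))

module Construction (H : ℕ) where

  Vertex : Set
  Vertex = Fin 1 ⊎ Tree H H

  root : Vertex
  root = inj₁ zero

  parents : Vertex → Parents Vertex
  parents (inj₁ _) = none
  parents (inj₂ x) = treeParents root inj₂ x

  depth : Vertex → ℕ
  depth (inj₁ _) = 0
  depth (inj₂ x) = treeDepth 1 x

  DiamondCoherent : ∀ {a b} → Vertex → Vertex → (Diamond a b → Vertex) → Set
  DiamondCoherent u v e = ∀ y → parents (e y) ≡ diamondParents u v e y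

  TreeCoherent : ∀ {h} → Vertex → (Tree H h → Vertex) → Set
  TreeCoherent r e = ∀ y → parents (e y) ≡ treeParents r e y

  apex-parents : ∀ {a b u v} {e : Diamond (suc a) (suc b) → Vertex} → DiamondCoherent u v e → ∀ i →
                 u ∈ₚ parents (e (apex i)) × v ∈ₚ parents (e (apex i))
  apex-parents coherent i = subst (_ ∈ₚ_) (sym (coherent (apex i))) (inj₁ refl)
                          , subst (_ ∈ₚ_) (sym (coherent (apex i))) (inj₂ refl)

  child-parent : ∀ {h r} {e : Tree H (suc h) → Vertex} → TreeCoherent r e → ∀ i → r ∈ₚ parents (e (child i))
  child-parent coherent i = subst (_ ∈ₚ_) (sym (coherent (child i))) refl

  diamond-shallower : ∀ {a b} L {u v} (e : Diamond a b → Vertex) → depth u < L → depth v < L →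
                      (∀ y → depth (e y) ≡ diamondDepth L y) → ∀ x {p} → p ∈ₚ diamondParents u v e x → depth p < diamondDepth L x
  diamond-shallower L e u<L v<L depth-e (apex i) (inj₁ refl) = u<L
  diamond-shallower L e u<L v<L depth-e (apex i) (inj₂ refl) = v<L
  diamond-shallower L e u<L v<L depth-e (onRightEdge i x) =
    diamond-shallower (suc L) (λ y → e (onRightEdge i y)) (ℕ.≤-reflexive (cong suc (depth-e (apex i)))) (ℕ.m<n⇒m<1+n v<L)
      (λ y → depth-e (onRightEdge i y)) x
  diamond-shallower L e u<L v<L depth-e (onLeftEdge i x) =
    diamond-shallower (suc L) (λ y → e (onLeftEdge i y)) (ℕ.m<n⇒m<1+n u<L) (ℕ.≤-reflexive (cong suc (depth-e (apex i))))
      (λ y → depth-e (onLeftEdge i y)) x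

  tree-shallower : ∀ {h} L {r} (e : Tree H h → Vertex) → depth r < L →
                   (∀ y → depth (e y) ≡ treeDepth L y) → ∀ x {p} → p ∈ₚ treeParents r e x → depth p < treeDepth L x
  tree-shallower L e r<L depth-e (child i) refl = r<L
  tree-shallower L e r<L depth-e (inside i x) =
    tree-shallower (suc L) (λ y → e (inside i y)) (ℕ.≤-reflexive (cong suc (depth-e (child i)))) (λ y → depth-e (inside i y)) x
  tree-shallower L e r<L depth-e (onEdge i x) =
    diamond-shallower (suc L) (λ y → e (onEdge i y)) (ℕ.m<n⇒m<1+n r<L) (ℕ.≤-reflexive (cong suc (depth-e (child i))))
      (λ y → depth-e (onEdge i y)) x

  shallower : ∀ {p x} → p ∈ₚ parents x → depth p < depth x
  shallower {x = inj₁ _} ()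
  shallower {x = inj₂ x} = tree-shallower 1 inj₂ (s≤s z≤n) (λ _ → refl) x

  diamond-linked : ∀ {a b u v} (e : Diamond a b → Vertex) → DiamondCoherent u v e → Linked parents u v →
                   ∀ x {p q} → diamondParents u v e x ≡ two p q → Linked parents p q
  diamond-linked e coherent u~v (apex i) refl = u~v
  diamond-linked e coherent u~v (onRightEdge i x) =
    diamond-linked (λ y → e (onRightEdge i y)) (λ y → coherent (onRightEdge i y)) (inj₂ (proj₂ (apex-parents coherent i))) x
  diamond-linked e coherent u~v (onLeftEdge i x) =
    diamond-linked (λ y → e (onLeftEdge i y)) (λ y → coherent (onLeftEdge i y)) (inj₁ (proj₁ (apex-parents coherent i))) x

  tree-linked : ∀ {h r} (e : Tree H h → Vertex) → TreeCoherent r e → ∀ x {p q} → treeParents r e x ≡ two p q → Linked parents p q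
  tree-linked e coherent (child i) ()
  tree-linked e coherent (inside i x) =
    tree-linked (λ y → e (inside i y)) (λ y → coherent (inside i y)) x
  tree-linked e coherent (onEdge i x) =
    diamond-linked (λ y → e (onEdge i y)) (λ y → coherent (onEdge i y)) (inj₁ (child-parent coherent i)) x

  linked-parents : ∀ {x p q} → parents x ≡ two p q → Linked parents p q
  linked-parents {inj₁ _} ()
  linked-parents {inj₂ x} = tree-linked inj₂ (λ _ → refl) x

  size : ℕ
  size = 1 + treeSize H H

  -- opaque, so that typechecking never unfolds the composite bijection
  opaque
    encoding : Vertex ↔ Fin size
    encoding = ↔-trans (↔-refl ⊎-↔ tree↔ H H) (↔-sym +↔⊎)

  module Graphs = ParentGraph parents depth (λ {p} {x} → shallower {p} {x}) (λ {x} {p} {q} → linked-parents {x} {p} {q})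
  open Graphs public using (graph)
  open Graphs.OnFin encoding public using (graphFin; series-parallel)

rightPieces : ∀ {a b} → Pieces (Diamond (suc a) (suc b)) (Diamond a (suc b)) 5
rightPieces = record { centre = apex ; beyond = onRightEdge ; centre-injective = λ { refl → refl }
                     ; beyond-injective = λ { refl → refl , refl } ; beyond≢centre = λ () }

leftPieces : ∀ {a b} → Pieces (Diamond (suc a) (suc b)) (Diamond (suc a) b) 5
leftPieces = record { centre = apex ; beyond = onLeftEdge ; centre-injective = λ { refl → refl }
                    ; beyond-injective = λ { refl → refl , refl } ; beyond≢centre = λ () }

subtreePieces : ∀ {H h} → Pieces (Tree H (suc h)) (Tree H h) 3
subtreePieces = record { centre = child ; beyond = inside ; centre-injective = λ { refl → refl }
                       ; beyond-injective = λ { refl → refl , refl } ; beyond≢centre = λ () }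

edgePieces : ∀ {H h} → Pieces (Tree H (suc h)) (Diamond H H) 3
edgePieces = record { centre = child ; beyond = onEdge ; centre-injective = λ { refl → refl }
                    ; beyond-injective = λ { refl → refl , refl } ; beyond≢centre = λ () }

module Colouring (c : ℕ) (part : Fin (Construction.size (suc c)) → Bool)
  (Dtrue  : PathDecomposition (induced (Construction.graphFin (suc c)) (λ v → part v ≡ true)) c)
  (Dfalse : PathDecomposition (induced (Construction.graphFin (suc c)) (λ v → part v ≡ false)) c) where
  open Construction (suc c)
  open Pieces using (piece; piece⊆image; pieces-disjoint; copy-injective; copy-avoids-centre)

  col : Vertex → Bool
  col v = part (Inverse.to encoding v)

  decomposition : ∀ b → ColourClasses.ClassDecomposition graph col c b
  decomposition true  = classDecomposition graph encoding part c true Dtrue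
  decomposition false = classDecomposition graph encoding part c false Dfalse

  open Branching graph col c decomposition

  widen : ∀ {b R R′ x k} → R ⊆ R′ → RootedIn b R x k → RootedIn b R′ x k
  widen R⊆R′ (A , rooted , A⊆R) = A , rooted , λ y∈A → R⊆R′ (A⊆R y∈A)

  singleton-in : ∀ {S : Set} x (e : S → Vertex) → RootedIn (col x) (Region x e) x 0
  singleton-in x e = ｛ x ｝ , singleton x , inj₁

  too-wide : ∀ {b R x} → ¬ RootedIn b R x (suc c)
  too-wide (_ , (_ , wide) , _) = not-wide wide

  arm : ∀ {b x p R k} → Adj graph x p → col p ≡ b → RootedIn (col p) R p k → Arm b x R k
  arm x~p refl (A , rooted , A⊆R) = record { root = _ ; set = A ; rooted = rooted ; within = A⊆R ; adjacent = x~p }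

  grow : ∀ {S T m b x k} {e : S → Vertex} (P : Pieces S T m) → Distinct e → (∀ z → e z ≢ x) → col x ≡ b →
         ∀ {i j l} → i ≢ j → i ≢ l → j ≢ l →
         Arm b x (piece P e i) k → Arm b x (piece P e j) k → Arm b x (piece P e l) k → RootedIn b (Region x e) x (suc k)
  grow {x = x} {e = e} P injective x∉ cx i≢j i≢l j≢l Aᵢ Aⱼ Aₗ =
    widen ⊆region (branching cx (outside _) (outside _) (outside _)
                   (pieces-disjoint P e injective i≢j) (pieces-disjoint P e injective i≢l)
                   (pieces-disjoint P e injective j≢l) Aᵢ Aⱼ Aₗ)
    where
      outside : ∀ i → x ∉ piece P e i
      outside i (inj₁ e′)      = x∉ _ e′
      outside i (inj₂ (y , e′)) = x∉ _ e′
      ⊆region : ∀ {i j l} → ｛ x ｝ ∪ piece P e i ∪ piece P e j ∪ piece P e l ⊆ Region x e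
      ⊆region (inj₁ refl)              = inj₁ refl
      ⊆region (inj₂ (inj₁ y∈))        = inj₂ (piece⊆image P e y∈)
      ⊆region (inj₂ (inj₂ (inj₁ y∈))) = inj₂ (piece⊆image P e y∈)
      ⊆region (inj₂ (inj₂ (inj₂ y∈))) = inj₂ (piece⊆image P e y∈)

  record DiamondCopy (a b : ℕ) : Set where
    field
      left right : Vertex
      embed      : Diamond a b → Vertex
      coherent   : DiamondCoherent left right embed
      injective  : Distinct embed
      left∉      : ∀ y → embed y ≢ left
      right∉     : ∀ y → embed y ≢ right

  record TreeCopy (h : ℕ) : Set where
    field
      top       : Vertex
      embed     : Tree (suc c) h → Vertex
      coherent  : TreeCoherent top embed
      injective : Distinct embed
      top∉      : ∀ y → embed y ≢ top

  rightCopy : ∀ {a b} → Fin 5 → DiamondCopy (suc a) (suc b) → DiamondCopy a (suc b)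
  rightCopy i D = record
    { left = embed (apex i) ; right = right ; embed = λ y → embed (onRightEdge i y)
    ; coherent = λ y → coherent (onRightEdge i y) ; injective = copy-injective rightPieces embed injective i
    ; left∉ = copy-avoids-centre rightPieces embed injective i ; right∉ = λ y → right∉ (onRightEdge i y) }
    where open DiamondCopy D

  leftCopy : ∀ {a b} → Fin 5 → DiamondCopy (suc a) (suc b) → DiamondCopy (suc a) b
  leftCopy i D = record
    { left = left ; right = embed (apex i) ; embed = λ y → embed (onLeftEdge i y)
    ; coherent = λ y → coherent (onLeftEdge i y) ; injective = copy-injective leftPieces embed injective i
    ; left∉ = λ y → left∉ (onLeftEdge i y) ; right∉ = copy-avoids-centre leftPieces embed injective i }
    where open DiamondCopy D

  subtreeCopy : ∀ {h} → Fin 3 → TreeCopy (suc h) → TreeCopy h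
  subtreeCopy i T = record
    { top = embed (child i) ; embed = λ y → embed (inside i y) ; coherent = λ y → coherent (inside i y)
    ; injective = copy-injective subtreePieces embed injective i ; top∉ = copy-avoids-centre subtreePieces embed injective i }
    where open TreeCopy T

  edgeCopy : ∀ {h} → Fin 3 → TreeCopy (suc h) → DiamondCopy (suc c) (suc c)
  edgeCopy i T = record
    { left = top ; right = embed (child i) ; embed = λ y → embed (onEdge i y)
    ; coherent = λ y → coherent (onEdge i y) ; injective = copy-injective edgePieces embed injective i
    ; left∉ = λ y → top∉ (onEdge i y) ; right∉ = copy-avoids-centre edgePieces embed injective i }
    where open TreeCopy T

  Outcome : ∀ {a b} → DiamondCopy a b → Set₁
  Outcome {a} {b} D = RootedIn (col left) (Region left embed) left a ⊎ RootedIn (col right) (Region right embed) right b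
    where open DiamondCopy D

  -- Induction on the budgets: three apexes share a colour, say that of the
  -- left end; the gadget beyond each of them yields an arm at the left end
  -- (then branching applies) unless the right end is already rooted there.
  bichromatic : ∀ a b (D : DiamondCopy a b) → col (DiamondCopy.left D) ≢ col (DiamondCopy.right D) → Outcome D
  bichromatic zero    b       D _ = inj₁ (singleton-in _ _)
  bichromatic (suc a) zero    D _ = inj₂ (singleton-in _ _)
  bichromatic (suc a) (suc b) D differ = by-majority (three-alike (λ i → col (embed (apex i))))
    where
      open DiamondCopy D

      left~apex : ∀ i → Adj graph left (embed (apex i))
      left~apex i = inj₁ (proj₁ (apex-parents coherent i))
      right~apex : ∀ i → Adj graph right (embed (apex i))
      right~apex i = inj₁ (proj₂ (apex-parents coherent i))

      attempt-left : ∀ i → col (embed (apex i)) ≡ col left →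
                     Arm (col left) left (piece rightPieces embed i) a ⊎ RootedIn (col right) (Region right embed) right (suc b)
      attempt-left i same with bichromatic a (suc b) (rightCopy i D) (λ e → differ (trans (sym same) e))
      ... | inj₁ R = inj₁ (arm (left~apex i) same R)
      ... | inj₂ R = inj₂ (widen (region-mono (onRightEdge i)) R)

      attempt-right : ∀ i → col (embed (apex i)) ≡ col right →
                      Arm (col right) right (piece leftPieces embed i) b ⊎ RootedIn (col left) (Region left embed) left (suc a)
      attempt-right i same with bichromatic (suc a) b (leftCopy i D) (λ e → differ (trans e same))
      ... | inj₁ R = inj₂ (widen (region-mono (onLeftEdge i)) R)
      ... | inj₂ R = inj₁ (arm (right~apex i) same R)

      towards-left : ThreeOf (λ i → col (embed (apex i)) ≡ col left) → Outcome D
      towards-left (three i j k i≢j i≢k j≢k Pi Pj Pk)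
        with all-or-escape (attempt-left i Pi) (attempt-left j Pj) (attempt-left k Pk)
      ... | inj₁ (Aᵢ , Aⱼ , Aₖ) = inj₁ (grow rightPieces injective left∉ refl i≢j i≢k j≢k Aᵢ Aⱼ Aₖ)
      ... | inj₂ escape         = inj₂ escape

      towards-right : ThreeOf (λ i → col (embed (apex i)) ≡ col right) → Outcome D
      towards-right (three i j k i≢j i≢k j≢k Pi Pj Pk)
        with all-or-escape (attempt-right i Pi) (attempt-right j Pj) (attempt-right k Pk)
      ... | inj₁ (Aᵢ , Aⱼ , Aₖ) = inj₂ (grow leftPieces injective right∉ refl i≢j i≢k j≢k Aᵢ Aⱼ Aₖ)
      ... | inj₂ escape         = inj₁ escape

      by-majority : (∃ λ β → ThreeOf (λ i → col (embed (apex i)) ≡ β)) → Outcome D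
      by-majority (β , apexes) with β ≟ᴮ col left
      ... | yes refl  = towards-left apexes
      ... | no β≢left = towards-right (three-map (λ e → trans e (both-other β≢left (λ e′ → differ (sym e′)))) apexes)

  -- Every copy of the tree of height h is h-rooted at its top: each child
  -- has the colour of the top (else the gadget on that edge is rooted to
  -- budget c+1, which is impossible), so branching applies.
  tree : ∀ h (T : TreeCopy h) → let open TreeCopy T in RootedIn (col top) (Region top embed) top h
  tree zero    T = singleton-in _ _
  tree (suc h) T = grow subtreePieces injective top∉ refl (λ ()) (λ ()) (λ ()) (branch 0F) (branch 1F) (branch 2F)
    where
      open TreeCopy T
      branch : ∀ i → Arm (col top) top (piece subtreePieces embed i) h
      branch i with col (embed (child i)) ≟ᴮ col top
      ... | yes same  = arm (inj₁ (child-parent coherent i)) same (tree h (subtreeCopy i T))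
      ... | no differ = ⊥-elim ([ too-wide , too-wide ] (bichromatic (suc c) (suc c) (edgeCopy i T) λ e → differ (sym e)))

  contradiction : ⊥
  contradiction = too-wide (tree (suc c) whole)
    where
      whole : TreeCopy (suc c)
      whole = record { top = root ; embed = inj₂ ; coherent = λ _ → refl ; injective = λ { refl → refl } ; top∉ = λ _ () }

proposition35 : ¬ (Σ ℕ λ c → ∀ (n : ℕ) (G : Graph (Fin n)) → SeriesParallel G →
                  Σ (Fin n → Bool) λ part →
                    PathwidthAtMost (induced G (λ v → part v ≡ true)) c ×
                    PathwidthAtMost (induced G (λ v → part v ≡ false)) c)
proposition35 (c , split)
  with part , Dtrue , Dfalse ← split _ (Construction.graphFin (suc c)) (Construction.series-parallel (suc c))
  = Colouring.contradiction c part Dtrue Dfalse
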